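{- Let $\Gamma=\langle\alpha_1,\ldots,\alpha_k\rangle\subset\mathbb N^d$ be an affine semigroup and let $H$ be its Graver basis. For $\beta\in\mathbb Z^d$ define a graph $T_\beta$ on vertex set $\mathsf Z(\beta)$ recursively as follows (with $\mathsf Z(\beta)=\emptyset$ if $\beta\notin\Gamma$): if $|\mathsf Z(\beta)|\le 1$, $T_\beta$ has no edges; otherwise, let $E'$ be the set of $(z,w)\in H$ with $z,w\in\mathsf Z(\beta)$, for each $i\le k$ let $T_i$ be the image of $T_{\beta-\alpha_i}$ under the cover morphism $\psi_i$ (i.e. vertices $z\mapsto z+e_i$, edges $\{z,w\}\mapsto\{z+e_i,w+e_i\}$), and let $T_\beta$ be the output of Kruskal's algorithm applied to the graph $(\mathsf Z(\beta),E(T_1)\cup\cdots\cup E(T_k)\cup E')$ with edge weights $\mathrm{dist}$, i.e. a spanning tree of that graph of minimal total edge weight. Then for every $\gamma\in\Gamma$, $\max\{\mathrm{dist}(z,w):\{z,w\}\in E(T_\gamma)\}$ (taken to be $0$ if $T_\gamma$ has no edges) equals the catenary degree $\mathsf c(\gamma)$.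
   Context: An affine semigroup is a finitely generated submonoid of $\mathbb N^d$ with minimal generating set $\alpha_1,\ldots,\alpha_k$; $\varphi_\Gamma(z)=z_1\alpha_1+\cdots+z_k\alpha_k$, $\mathsf Z(\gamma)=\varphi_\Gamma^{ -1}(\gamma)\subseteq\mathbb N^k$, $|z|=z_1+\cdots+z_k$, and $e_i$ is the $i$-th unit vector of $\mathbb N^k$. The Graver basis of $\Gamma$ is the minimal generating set of the affine semigroup $\{(z,w)\in\mathbb N^k\times\mathbb N^k:\varphi_\Gamma(z)=\varphi_\Gamma(w)\}$. For $z,w\in\mathbb N^k$, $\gcd(z,w)=(\min(z_1,w_1),\ldots,\min(z_k,w_k))$ and $\mathrm{dist}(z,w)=\max(|z-\gcd(z,w)|,|w-\gcd(z,w)|)$. An $N$-chain between $z,w\in\mathsf Z(\gamma)$ is a sequence $z=z_0,\ldots,z_r=w$ in $\mathsf Z(\gamma)$ with $\mathrm{dist}(z_{i-1},z_i)\le N$ for all $i$; the catenary degree $\mathsf c(\gamma)$ is the least $N\ge0$ such that any two factorizations of $\gamma$ are joined by an $N$-chain. -}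

module Defs where

open import Data.Nat using (ℕ; zero; suc; _+_; _*_; _∸_; _⊓_; _⊔_; _≤_)
open import Data.Fin using (Fin; zero; suc; _≟_)
open import Data.Vec using (Vec; []; _∷_; zipWith; map; replicate; tabulate; sum)
open import Data.List using (List; []; _∷_; foldr; length; lookup; removeAt)
open import Data.List.Relation.Unary.All using (All)
open import Data.List.Membership.Propositional using (_∈_)
open import Data.Product using (Σ; ∃; _×_; _,_; proj₁; proj₂)
open import Data.Sum using (_⊎_)
open import Relation.Nullary using (¬_; does)
open import Relation.Binary.PropositionalEquality using (_≡_; _≢_)
open import Relation.Binary.Construct.Closure.Equivalence using (EqClosure)
open import Relation.Binary.Construct.Closure.ReflexiveTransitive using (Star)
open import Data.Bool using (if_then_else_)

_⊕_ : ∀ {n} → Vec ℕ n → Vec ℕ n → Vec ℕ n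
_⊕_ = zipWith _+_

0v : ∀ {n} → Vec ℕ n
0v = replicate _ 0

e : ∀ {k} → Fin k → Vec ℕ k
e i = tabulate (λ j → if does (i ≟ j) then 1 else 0)

∣_∣ : ∀ {k} → Vec ℕ k → ℕ
∣ z ∣ = sum z

φ : ∀ {d k} → (Fin k → Vec ℕ d) → Vec ℕ k → Vec ℕ d
φ α [] = 0v
φ α (z ∷ zs) = map (z *_) (α zero) ⊕ φ (λ i → α (suc i)) zs

Z : ∀ {d k} → (Fin k → Vec ℕ d) → Vec ℕ d → Vec ℕ k → Set
Z α β z = φ α z ≡ β

InΓ : ∀ {d k} → (Fin k → Vec ℕ d) → Vec ℕ d → Set
InΓ α γ = ∃ λ z → φ α z ≡ γ

gcdv : ∀ {k} → Vec ℕ k → Vec ℕ k → Vec ℕ k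
gcdv = zipWith _⊓_

dist : ∀ {k} → Vec ℕ k → Vec ℕ k → ℕ
dist z w = ∣ zipWith _∸_ z (gcdv z w) ∣ ⊔ ∣ zipWith _∸_ w (gcdv z w) ∣

Generates : {X : Set} → (X → X → X) → X → (X → Set) → (X → Set) → Set
Generates _∙_ ε H M =
  ∀ x → M x → Σ (List _) λ hs → All H hs × foldr _∙_ ε hs ≡ x

IsMinimalGeneratingSet : {X : Set} → (X → X → X) → X → (X → Set) → (X → Set) → Set
IsMinimalGeneratingSet _∙_ ε H M =
  (∀ x → H x → M x) ×
  Generates _∙_ ε H M ×
  (∀ h → H h → ¬ Generates _∙_ ε (λ x → H x × x ≢ h) M)

IsMinimalGenerators : ∀ {d k} → (Fin k → Vec ℕ d) → Set
IsMinimalGenerators α =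
  (∀ i j → α i ≡ α j → i ≡ j) ×
  IsMinimalGeneratingSet _⊕_ 0v (λ x → ∃ λ i → α i ≡ x) (InΓ α)

Pair : ℕ → Set
Pair k = Vec ℕ k × Vec ℕ k

_⊕p_ : ∀ {k} → Pair k → Pair k → Pair k
(z , w) ⊕p (z' , w') = (z ⊕ z') , (w ⊕ w')

KerMonoid : ∀ {d k} → (Fin k → Vec ℕ d) → Pair k → Set
KerMonoid α (z , w) = φ α z ≡ φ α w

IsGraverBasis : ∀ {d k} → (Fin k → Vec ℕ d) → (Pair k → Set) → Set
IsGraverBasis α H = IsMinimalGeneratingSet _⊕p_ (0v , 0v) H (KerMonoid α)

-- Graphs on ℕ^k: a graph with finitely many edges is a list of
-- (unordered) edges; a general graph is given by an edge predicate.

InL : ∀ {k} → List (Pair k) → Vec ℕ k → Vec ℕ k → Set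
InL L z w = (z , w) ∈ L

Conn : ∀ {k} → (Vec ℕ k → Vec ℕ k → Set) → Vec ℕ k → Vec ℕ k → Set
Conn G = EqClosure G

weight : ∀ {k} → List (Pair k) → ℕ
weight = foldr (λ p m → dist (proj₁ p) (proj₂ p) + m) 0

maxDist : ∀ {k} → List (Pair k) → ℕ
maxDist = foldr (λ p m → dist (proj₁ p) (proj₂ p) ⊔ m) 0

-- L is a spanning forest of the graph G (with vertex set containing all
-- endpoints of edges of G): every edge of L is an edge of G, L has the
-- same connected components as G, and L is acyclic (every edge of L,
-- counted with multiplicity, is a bridge of L; this also excludes loops
-- and repeated edges).
IsSpanningForest : ∀ {k} → (Vec ℕ k → Vec ℕ k → Set) → List (Pair k) → Set
IsSpanningForest G L =
  (∀ {z w} → (z , w) ∈ L → G z w ⊎ G w z) ×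
  (∀ z w → Conn G z w → Conn (InL L) z w) ×
  (∀ (p : Fin (length L)) →
     ¬ Conn (InL (removeAt L p)) (proj₁ (lookup L p)) (proj₂ (lookup L p)))

-- minimum spanning forest w.r.t. edge weights dist (= possible outputs of
-- Kruskal's algorithm)
IsMinSpanningForest : ∀ {k} → (Vec ℕ k → Vec ℕ k → Set) → List (Pair k) → Set
IsMinSpanningForest G L =
  IsSpanningForest G L ×
  (∀ L' → IsSpanningForest G L' → weight L ≤ weight L')

AtMostOne : ∀ {d k} → (Fin k → Vec ℕ d) → Vec ℕ d → Set
AtMostOne α β = ∀ z w → Z α β z → Z α β w → z ≡ w

-- edges of T_i = ψ_i(T_{β - α_i}); empty if β - α_i ∉ ℕ^d
CoverEdge : ∀ {d k} → (Fin k → Vec ℕ d) → (Vec ℕ d → List (Pair k)) →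
            Vec ℕ d → Fin k → Vec ℕ k → Vec ℕ k → Set
CoverEdge α T β i z w =
  Σ (Vec ℕ _) λ β' → (β' ⊕ α i ≡ β) ×
  Σ (Vec ℕ _) λ z' → Σ (Vec ℕ _) λ w' →
    (z ≡ z' ⊕ e i) × (w ≡ w' ⊕ e i) × ((z' , w') ∈ T β')

Gβ : ∀ {d k} → (Fin k → Vec ℕ d) → (Pair k → Set) → (Vec ℕ d → List (Pair k)) →
     Vec ℕ d → Vec ℕ k → Vec ℕ k → Set
Gβ α H T β z w =
  Z α β z × Z α β w × ((∃ λ i → CoverEdge α T β i z w) ⊎ H (z , w))

-- T is a valid family T_β (β ∈ ℕ^d; for β ∈ ℤ^d ∖ ℕ^d, Z(β) = ∅)
IsTFamily : ∀ {d k} → (Fin k → Vec ℕ d) → (Pair k → Set) → (Vec ℕ d → List (Pair k)) → Set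
IsTFamily α H T = ∀ β →
  (AtMostOne α β → T β ≡ []) ×
  (¬ AtMostOne α β → IsMinSpanningForest (Gβ α H T β) (T β))

ChainStep : ∀ {d k} → (Fin k → Vec ℕ d) → Vec ℕ d → ℕ → Vec ℕ k → Vec ℕ k → Set
ChainStep α γ N z y = Z α γ z × Z α γ y × dist z y ≤ N

AllNChained : ∀ {d k} → (Fin k → Vec ℕ d) → Vec ℕ d → ℕ → Set
AllNChained {k = k} α γ N =
  ∀ (z w : Vec ℕ k) → Z α γ z → Z α γ w → Star (ChainStep α γ N) z w

IsCatenaryDegree : ∀ {d k} → (Fin k → Vec ℕ d) → Vec ℕ d → ℕ → Set
IsCatenaryDegree α γ N = AllNChained α γ N × (∀ M → AllNChained α γ M → N ≤ M)

-- Write Light N R for the edges of a graph R of weight (= dist) at most N,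
-- and say that R lightly connects a vertex set S if any two a, b ∈ S with
-- dist a b ≤ N are joined by a path of edges of Light N R.
--
-- (1) Minimum spanning forests preserve light connectivity (the minimax
--     path property): a heavy forest edge on the path between the two
--     endpoints of a light graph edge could be exchanged for that graph
--     edge, lowering the total weight.
-- (2) The graph G_γ = (Z(γ), E(T_1) ∪ … ∪ E(T_k) ∪ E') lightly connects
--     Z(γ), by well-founded induction on |γ|: for a, b ∈ Z(γ) decompose
--     (a - gcd(a,b), b - gcd(a,b)) into Graver elements and replace them
--     one at a time; each replacement is either an edge of E' or, when the
--     two factorizations share an atom α_i, a shifted light path of
--     T_{γ-α_i} given by the induction hypothesis and (1).
--
-- Hence T_γ lightly connects Z(γ).  Taking N = dist z w shows that the
-- edges of T_γ give maxDist(T_γ)-chains; conversely an M-chain yields,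
-- via light connectivity, a path of T_γ-edges of weight ≤ M between the
-- endpoints of any edge of T_γ, which by acyclicity forces that edge to
-- weigh at most M.

module Submission where

open import Defs
open import Level using (0ℓ)
open import Algebra.Bundles using (CommutativeSemigroup)
import Algebra.Properties.CommutativeSemigroup as CommutativeSemigroupProperties
open import Data.Nat using (ℕ; zero; suc; _+_; _*_; _∸_; _⊓_; _⊔_; _≤_; _<_; _≤?_; z≤n)
open import Data.Nat.Properties
open import Data.Nat.Induction using (<-wellFounded)
open import Data.Fin using (Fin; zero; suc; toℕ; fromℕ<) renaming (_≟_ to _≟ᶠ_)
open import Data.Fin.Properties using (toℕ-injective; toℕ<n; toℕ-fromℕ<)
open import Data.Vec using (Vec; []; _∷_; zipWith; map; allFin)
open import Data.Vec.Properties
  using (≡-dec; zipWith-assoc; zipWith-comm; zipWith-identityˡ; zipWith-identityʳ;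
         map-const; map-cong; map-id; tabulate-cong; tabulate-allFin; ∷-injectiveˡ; ∷-injectiveʳ)
open import Data.List using (List; []; _∷_; foldr; length; lookup; removeAt)
open import Data.List.Relation.Unary.All using (All; []; _∷_)
open import Data.List.Relation.Unary.Any using (here; there; index)
open import Data.List.Relation.Unary.Any.Properties using (lookup-index)
open import Data.List.Membership.Propositional using (_∈_)
open import Data.List.Membership.Propositional.Properties using (∈-lookup; ∉[])
open import Data.Product using (Σ; _×_; _,_; proj₁; proj₂)
open import Data.Sum using (_⊎_; inj₁; inj₂; [_,_]′; map₂)
open import Data.Bool using (if_then_else_)
open import Data.Empty using (⊥; ⊥-elim)
open import Function using (_∘_; id)
open import Relation.Nullary using (¬_; does; yes; no)
open import Relation.Binary.Definitions using (DecidableEquality)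
open import Relation.Binary.PropositionalEquality
open import Relation.Binary.PropositionalEquality.Algebra using (isMagma)
open import Relation.Binary.Construct.Closure.ReflexiveTransitive using (ε; _◅_; _◅◅_)
import Relation.Binary.Construct.Closure.ReflexiveTransitive as Star
open import Relation.Binary.Construct.Closure.Symmetric using (SymClosure; fwd; bwd)
open import Relation.Binary.Construct.Closure.Equivalence using (EqClosure; _⋆)
import Relation.Binary.Construct.Closure.Equivalence as EqClosure
import Relation.Binary.Construct.On as On
open import Induction.WellFounded using (module All)

⊕-assoc : ∀ {n} (x y z : Vec ℕ n) → (x ⊕ y) ⊕ z ≡ x ⊕ (y ⊕ z)
⊕-assoc = zipWith-assoc +-assoc

⊕-comm : ∀ {n} (x y : Vec ℕ n) → x ⊕ y ≡ y ⊕ x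
⊕-comm = zipWith-comm +-comm

⊕-identityˡ : ∀ {n} (x : Vec ℕ n) → 0v ⊕ x ≡ x
⊕-identityˡ = zipWith-identityˡ +-identityˡ

⊕-identityʳ : ∀ {n} (x : Vec ℕ n) → x ⊕ 0v ≡ x
⊕-identityʳ = zipWith-identityʳ +-identityʳ

⊕-cancelʳ : ∀ {n} (x y c : Vec ℕ n) → x ⊕ c ≡ y ⊕ c → x ≡ y
⊕-cancelʳ []      []      []      _  = refl
⊕-cancelʳ (a ∷ x) (b ∷ y) (c ∷ z) eq =
  cong₂ _∷_ (+-cancelʳ-≡ c a b (∷-injectiveˡ eq)) (⊕-cancelʳ x y z (∷-injectiveʳ eq))

-- (ℕ^n, ⊕) as a commutative semigroup, to reuse the library's rearrangements.
⊕-commutativeSemigroup : ℕ → CommutativeSemigroup 0ℓ 0ℓ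
⊕-commutativeSemigroup n = record
  { Carrier = Vec ℕ n
  ; _≈_     = _≡_
  ; _∙_     = _⊕_
  ; isCommutativeSemigroup = record
    { isSemigroup = record { isMagma = isMagma _⊕_ ; assoc = ⊕-assoc }
    ; comm        = ⊕-comm
    }
  }

module ⊕-Reorder {n : ℕ} = CommutativeSemigroupProperties (⊕-commutativeSemigroup n)
module +-Reorder = CommutativeSemigroupProperties +-commutativeSemigroup

∣⊕∣ : ∀ {n} (x y : Vec ℕ n) → ∣ x ⊕ y ∣ ≡ ∣ x ∣ + ∣ y ∣
∣⊕∣ []      []      = refl
∣⊕∣ (a ∷ x) (b ∷ y) = trans (cong (a + b +_) (∣⊕∣ x y)) (+-Reorder.interchange a b ∣ x ∣ ∣ y ∣)

∣∣-≤ˡ : ∀ {n} (x y : Vec ℕ n) → ∣ x ∣ ≤ ∣ x ⊕ y ∣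
∣∣-≤ˡ x y = ≤-trans (m≤m+n ∣ x ∣ ∣ y ∣) (≤-reflexive (sym (∣⊕∣ x y)))

∣∣-≤ʳ : ∀ {n} (x y : Vec ℕ n) → ∣ y ∣ ≤ ∣ x ⊕ y ∣
∣∣-≤ʳ x y = ≤-trans (m≤n+m ∣ y ∣ ∣ x ∣) (≤-reflexive (sym (∣⊕∣ x y)))

∣∣≡0⇒≡0v : ∀ {n} (x : Vec ℕ n) → ∣ x ∣ ≡ 0 → x ≡ 0v
∣∣≡0⇒≡0v []         _  = refl
∣∣≡0⇒≡0v (zero ∷ x) eq = cong (0 ∷_) (∣∣≡0⇒≡0v x eq)

e-zero : ∀ {n} → e {suc n} zero ≡ 1 ∷ 0v
e-zero {n} = cong (1 ∷_) (trans (tabulate-allFin (λ _ → 0)) (map-const (allFin n) 0))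

e-suc : ∀ {n} (i : Fin n) → e (suc i) ≡ 0 ∷ e i
e-suc i = cong (0 ∷_) (tabulate-cong same-test)
  where
  same-test : ∀ j → (if does (suc i ≟ᶠ suc j) then 1 else 0) ≡ (if does (i ≟ᶠ j) then 1 else 0)
  same-test j with i ≟ᶠ j
  ... | yes _ = refl
  ... | no  _ = refl

zero-or-unit : ∀ {n} (u : Vec ℕ n) → u ≡ 0v ⊎ Σ (Fin n) λ i → Σ (Vec ℕ n) λ u′ → u ≡ u′ ⊕ e i
zero-or-unit [] = inj₁ refl
zero-or-unit {suc n} (suc m ∷ u) =
  inj₂ (zero , m ∷ u , sym (trans (cong ((m ∷ u) ⊕_) (e-zero {n}))
                                  (cong₂ _∷_ (+-comm m 1) (⊕-identityʳ u))))
zero-or-unit (zero ∷ u) with zero-or-unit u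
... | inj₁ u≡0        = inj₁ (cong (0 ∷_) u≡0)
... | inj₂ (i , u′ , u≡) =
  inj₂ (suc i , 0 ∷ u′ , trans (cong (0 ∷_) u≡) (sym (cong ((0 ∷ u′) ⊕_) (e-suc i))))

private
  scale-+ : ∀ {n} a b (v : Vec ℕ n) → map ((a + b) *_) v ≡ map (a *_) v ⊕ map (b *_) v
  scale-+ a b []      = refl
  scale-+ a b (x ∷ v) = cong₂ _∷_ (*-distribʳ-+ x a b) (scale-+ a b v)

  scale-1 : ∀ {n} (v : Vec ℕ n) → map (1 *_) v ≡ v
  scale-1 v = trans (map-cong *-identityˡ v) (map-id v)

φ-⊕ : ∀ {d k} (α : Fin k → Vec ℕ d) (x y : Vec ℕ k) → φ α (x ⊕ y) ≡ φ α x ⊕ φ α y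
φ-⊕ α []      []      = sym (⊕-identityʳ 0v)
φ-⊕ α (a ∷ x) (b ∷ y) =
  trans (cong₂ _⊕_ (scale-+ a b (α zero)) (φ-⊕ (λ i → α (suc i)) x y))
        (⊕-Reorder.interchange (map (a *_) (α zero)) (map (b *_) (α zero)) _ _)

φ-0v : ∀ {d k} (α : Fin k → Vec ℕ d) → φ α 0v ≡ 0v
φ-0v {k = zero}  α = refl
φ-0v {k = suc k} α =
  trans (cong₂ _⊕_ (map-const (α zero) 0) (φ-0v (λ i → α (suc i)))) (⊕-identityʳ 0v)

φ-e : ∀ {d k} (α : Fin k → Vec ℕ d) (i : Fin k) → φ α (e i) ≡ α i
φ-e {k = suc k} α zero = begin
  φ α (e zero)                               ≡⟨ cong (φ α) (e-zero {k}) ⟩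
  map (1 *_) (α zero) ⊕ φ (λ i → α (suc i)) 0v ≡⟨ cong₂ _⊕_ (scale-1 (α zero)) (φ-0v (λ i → α (suc i))) ⟩
  α zero ⊕ 0v                                ≡⟨ ⊕-identityʳ (α zero) ⟩
  α zero                                     ∎
  where open ≡-Reasoning
φ-e {k = suc k} α (suc i) = begin
  φ α (e (suc i))                            ≡⟨ cong (φ α) (e-suc i) ⟩
  map (0 *_) (α zero) ⊕ φ (λ i → α (suc i)) (e i) ≡⟨ cong₂ _⊕_ (map-const (α zero) 0) (φ-e (λ i → α (suc i)) i) ⟩
  0v ⊕ α (suc i)                             ≡⟨ ⊕-identityˡ (α (suc i)) ⟩
  α (suc i)                                  ∎
  where open ≡-Reasoning

φ-⊕e : ∀ {d k} (α : Fin k → Vec ℕ d) (i : Fin k) (u : Vec ℕ k) → φ α (u ⊕ e i) ≡ φ α u ⊕ α i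
φ-⊕e α i u = trans (φ-⊕ α u (e i)) (cong (φ α u ⊕_) (φ-e α i))

excess : ∀ {n} → Vec ℕ n → Vec ℕ n → Vec ℕ n
excess x y = zipWith _∸_ x (gcdv x y)

gcdv-comm : ∀ {n} (x y : Vec ℕ n) → gcdv x y ≡ gcdv y x
gcdv-comm = zipWith-comm ⊓-comm

excess-split : ∀ {n} (x y : Vec ℕ n) → excess x y ⊕ gcdv x y ≡ x
excess-split []      []      = refl
excess-split (a ∷ x) (b ∷ y) = cong₂ _∷_ (m∸n+n≡m (m⊓n≤m a b)) (excess-split x y)

excess-split′ : ∀ {n} (x y : Vec ℕ n) → excess y x ⊕ gcdv x y ≡ y
excess-split′ x y = trans (cong (excess y x ⊕_) (gcdv-comm x y)) (excess-split y x)

dist-excess : ∀ {n} (x y : Vec ℕ n) → dist x y ≡ ∣ excess x y ∣ ⊔ ∣ excess y x ∣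
dist-excess x y = cong (λ g → ∣ excess x y ∣ ⊔ ∣ zipWith _∸_ y g ∣) (gcdv-comm x y)

dist-sym : ∀ {n} (x y : Vec ℕ n) → dist x y ≡ dist y x
dist-sym x y = trans (dist-excess x y) (trans (⊔-comm ∣ excess x y ∣ _) (sym (dist-excess y x)))

excess-translate : ∀ {n} (x y c : Vec ℕ n) → excess (x ⊕ c) (y ⊕ c) ≡ excess x y
excess-translate []      []      []      = refl
excess-translate (a ∷ x) (b ∷ y) (c ∷ z) = cong₂ _∷_ component (excess-translate x y z)
  where
  component : (a + c) ∸ ((a + c) ⊓ (b + c)) ≡ a ∸ (a ⊓ b)
  component = trans (cong₂ _∸_ (+-comm a c) (trans (sym (+-distribʳ-⊓ c a b)) (+-comm (a ⊓ b) c)))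
                    ([m+n]∸[m+o]≡n∸o c a (a ⊓ b))

dist-translate : ∀ {n} (x y c : Vec ℕ n) → dist (x ⊕ c) (y ⊕ c) ≡ dist x y
dist-translate x y c = begin
  dist (x ⊕ c) (y ⊕ c)                                     ≡⟨ dist-excess (x ⊕ c) (y ⊕ c) ⟩
  ∣ excess (x ⊕ c) (y ⊕ c) ∣ ⊔ ∣ excess (y ⊕ c) (x ⊕ c) ∣  ≡⟨ cong₂ (λ u v → ∣ u ∣ ⊔ ∣ v ∣) (excess-translate x y c) (excess-translate y x c) ⟩
  ∣ excess x y ∣ ⊔ ∣ excess y x ∣                          ≡⟨ dist-excess x y ⟨
  dist x y                                                 ∎
  where open ≡-Reasoning

size : ∀ {k} → Pair k → ℕ
size (z , w) = ∣ z ∣ ⊔ ∣ w ∣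

size-≤ˡ : ∀ {k} (p q : Pair k) → size p ≤ size (p ⊕p q)
size-≤ˡ (z , w) (c , c′) = ⊔-mono-≤ (∣∣-≤ˡ z c) (∣∣-≤ˡ w c′)

size-≤ʳ : ∀ {k} (p q : Pair k) → size q ≤ size (p ⊕p q)
size-≤ʳ (z , w) (c , c′) = ⊔-mono-≤ (∣∣-≤ʳ z c) (∣∣-≤ʳ w c′)

dist≤size : ∀ {n} (x y : Vec ℕ n) → dist x y ≤ size (x , y)
dist≤size x y = ≤-trans (≤-reflexive (dist-excess x y)) (⊔-mono-≤ (excess≤ x y) (excess≤ y x))
  where
  excess≤ : ∀ {n} (x y : Vec ℕ n) → ∣ excess x y ∣ ≤ ∣ x ∣
  excess≤ []      []      = z≤n
  excess≤ (a ∷ x) (b ∷ y) = +-mono-≤ (m∸n≤m a (a ⊓ b)) (excess≤ x y)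

-- No element of a minimal generating set is the identity: it could be
-- dropped from every factorization.
minimal-generator-≢-identity :
  {X : Set} {_∙_ : X → X → X} {ι : X} {H M : X → Set} → DecidableEquality X →
  (∀ x → ι ∙ x ≡ x) → IsMinimalGeneratingSet _∙_ ι H M → ∀ h → H h → h ≢ ι
minimal-generator-≢-identity {X} {_∙_} {ι} {H} _≟_ identityˡ (_ , generates , minimal) h Hh refl =
  minimal ι Hh λ x Mx →
    let (hs , Hhs , hs≡x) = generates x Mx
        (hs′ , Hhs′ , hs′≡hs) = drop-identity hs Hhs
    in hs′ , Hhs′ , trans hs′≡hs hs≡x
  where
  drop-identity : ∀ hs → All H hs →
    Σ (List X) λ hs′ → All (λ x → H x × x ≢ ι) hs′ × foldr _∙_ ι hs′ ≡ foldr _∙_ ι hs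
  drop-identity []       []         = [] , [] , refl
  drop-identity (x ∷ hs) (Hx ∷ Hhs) with x ≟ ι | drop-identity hs Hhs
  ... | yes refl | hs′ , Hhs′ , eq = hs′ , Hhs′ , trans eq (sym (identityˡ _))
  ... | no  x≢ι  | hs′ , Hhs′ , eq = x ∷ hs′ , (Hx , x≢ι) ∷ Hhs′ , cong (x ∙_) eq

module _ {A : Set} {B : A → A → Set} (h₁ h₂ : A) where

  -- A path in B plus the extra edge h₁h₂, read according to its use of that edge.
  ThroughEdge : A → A → Set
  ThroughEdge s t =
    EqClosure B s t ⊎ (EqClosure B s h₁ × EqClosure B h₂ t) ⊎ (EqClosure B s h₂ × EqClosure B h₁ t)

  private
    prepend : ∀ {s u t} → EqClosure B s u → ThroughEdge u t → ThroughEdge s t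
    prepend c (inj₁ d)             = inj₁ (c ◅◅ d)
    prepend c (inj₂ (inj₁ (d , f))) = inj₂ (inj₁ (c ◅◅ d , f))
    prepend c (inj₂ (inj₂ (d , f))) = inj₂ (inj₂ (c ◅◅ d , f))

    cross : ∀ {t} → ThroughEdge h₂ t → ThroughEdge h₁ t
    cross (inj₁ c)             = inj₂ (inj₁ (ε , c))
    cross (inj₂ (inj₁ (c , d))) = inj₁ (EqClosure.symmetric B c ◅◅ d)
    cross (inj₂ (inj₂ (_ , d))) = inj₁ d

    cross-back : ∀ {t} → ThroughEdge h₁ t → ThroughEdge h₂ t
    cross-back (inj₁ c)             = inj₂ (inj₂ (ε , c))
    cross-back (inj₂ (inj₁ (_ , d))) = inj₁ d
    cross-back (inj₂ (inj₂ (c , d))) = inj₁ (EqClosure.symmetric B c ◅◅ d)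

  split-at-edge : ∀ {R : A → A → Set} → (∀ {u v} → R u v → B u v ⊎ (u ≡ h₁ × v ≡ h₂)) →
                  ∀ {s t} → EqClosure R s t → ThroughEdge s t
  split-at-edge classify ε = inj₁ ε
  split-at-edge classify (fwd r ◅ c) with classify r
  ... | inj₁ b             = prepend (EqClosure.return b) (split-at-edge classify c)
  ... | inj₂ (refl , refl) = cross (split-at-edge classify c)
  split-at-edge classify (bwd r ◅ c) with classify r
  ... | inj₁ b             = prepend (EqClosure.symmetric B (EqClosure.return b)) (split-at-edge classify c)
  ... | inj₂ (refl , refl) = cross-back (split-at-edge classify c)

module _ {A : Set} where

  ∈-removeAt⁻ : ∀ {x} (L : List A) p → x ∈ removeAt L p → x ∈ L
  ∈-removeAt⁻ (y ∷ L) zero    m         = there m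
  ∈-removeAt⁻ (y ∷ L) (suc p) (here eq) = here eq
  ∈-removeAt⁻ (y ∷ L) (suc p) (there m) = there (∈-removeAt⁻ L p m)

  ∈-lookup-or-removeAt : ∀ {x} (L : List A) p → x ∈ L → x ≡ lookup L p ⊎ x ∈ removeAt L p
  ∈-lookup-or-removeAt (y ∷ L) zero    (here eq) = inj₁ eq
  ∈-lookup-or-removeAt (y ∷ L) zero    (there m) = inj₂ m
  ∈-lookup-or-removeAt (y ∷ L) (suc p) (here eq) = inj₂ (here eq)
  ∈-lookup-or-removeAt (y ∷ L) (suc p) (there m) with ∈-lookup-or-removeAt L p m
  ... | inj₁ eq = inj₁ eq
  ... | inj₂ m′ = inj₂ (there m′)

  lookup-∈-removeAt : ∀ (L : List A) p q → q ≢ p → lookup L q ∈ removeAt L p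
  lookup-∈-removeAt (y ∷ L) zero    zero    q≢p = ⊥-elim (q≢p refl)
  lookup-∈-removeAt (y ∷ L) zero    (suc q) q≢p = ∈-lookup q
  lookup-∈-removeAt (y ∷ L) (suc p) zero    q≢p = here refl
  lookup-∈-removeAt (y ∷ L) (suc p) (suc q) q≢p = there (lookup-∈-removeAt L p q (q≢p ∘ cong suc))

-- Weighted graphs on ℕ^k and their spanning forests

module Forests {k : ℕ} where

  Graph : Set₁
  Graph = Vec ℕ k → Vec ℕ k → Set

  cost : Pair k → ℕ
  cost x = dist (proj₁ x) (proj₂ x)

  Light : ℕ → Graph → Graph
  Light N R u v = R u v × dist u v ≤ N

  LightlyConnects : (Vec ℕ k → Set) → Graph → Set
  LightlyConnects S R = ∀ N a b → S a → S b → dist a b ≤ N → Conn (Light N R) a b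

  weight-removeAt : ∀ (L : List (Pair k)) p → weight L ≡ cost (lookup L p) + weight (removeAt L p)
  weight-removeAt (y ∷ L) zero    = refl
  weight-removeAt (y ∷ L) (suc p) =
    trans (cong (cost y +_) (weight-removeAt L p)) (+-Reorder.x∙yz≈y∙xz (cost y) (cost (lookup L p)) (weight (removeAt L p)))

  ≤-maxDist : ∀ {x} (L : List (Pair k)) → x ∈ L → cost x ≤ maxDist L
  ≤-maxDist (y ∷ L) (here refl) = m≤m⊔n _ _
  ≤-maxDist (y ∷ L) (there m)   = ≤-trans (≤-maxDist L m) (m≤n⊔m _ _)

  maxDist-≤ : ∀ (L : List (Pair k)) {M} → (∀ p → cost (lookup L p) ≤ M) → maxDist L ≤ M
  maxDist-≤ []      bound = z≤n
  maxDist-≤ (y ∷ L) bound = ⊔-lub (bound zero) (maxDist-≤ L (bound ∘ suc))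

  Acyclic : List (Pair k) → Set
  Acyclic L = ∀ p → ¬ Conn (InL (removeAt L p)) (proj₁ (lookup L p)) (proj₂ (lookup L p))

  acyclic-tail : ∀ {x} R → Acyclic (x ∷ R) → Acyclic R
  acyclic-tail R acyclic p c = acyclic (suc p) (EqClosure.map there c)

  acyclic-cons : ∀ {x y} R → Acyclic R → ¬ Conn (InL R) x y → Acyclic ((x , y) ∷ R)
  acyclic-cons R acyclic x≁y zero c = x≁y c
  acyclic-cons {x} {y} R acyclic x≁y (suc q) c
    with split-at-edge {B = InL (removeAt R q)} x y classify c
    where
    classify : ∀ {u v} → InL ((x , y) ∷ removeAt R q) u v → InL (removeAt R q) u v ⊎ (u ≡ x × v ≡ y)
    classify (here refl) = inj₂ (refl , refl)
    classify (there m)   = inj₁ m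
  ... | inj₁ c′               = acyclic q c′
  ... | inj₂ (inj₁ (c₁ , c₂)) =
    x≁y (EqClosure.symmetric _ (widen c₁) ◅◅ EqClosure.return (∈-lookup q) ◅◅ EqClosure.symmetric _ (widen c₂))
    where
    widen : ∀ {u v} → Conn (InL (removeAt R q)) u v → Conn (InL R) u v
    widen = EqClosure.map (∈-removeAt⁻ R q)
  ... | inj₂ (inj₂ (c₁ , c₂)) =
    x≁y (widen c₂ ◅◅ EqClosure.symmetric _ (EqClosure.return (∈-lookup q)) ◅◅ widen c₁)
    where
    widen : ∀ {u v} → Conn (InL (removeAt R q)) u v → Conn (InL R) u v
    widen = EqClosure.map (∈-removeAt⁻ R q)

  acyclic-removeAt : ∀ L p → Acyclic L → Acyclic (removeAt L p)
  acyclic-removeAt (x ∷ R)       zero    acyclic = acyclic-tail R acyclic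
  acyclic-removeAt ((x , y) ∷ R) (suc p) acyclic =
    acyclic-cons (removeAt R p) (acyclic-removeAt R p (acyclic-tail R acyclic))
                 (λ c → acyclic zero (EqClosure.map (∈-removeAt⁻ R p) c))

  acyclic-light-bound : ∀ L → Acyclic L → ∀ p M →
    Conn (Light M (InL L)) (proj₁ (lookup L p)) (proj₂ (lookup L p)) → cost (lookup L p) ≤ M
  acyclic-light-bound L acyclic p M c with cost (lookup L p) ≤? M
  ... | yes light = light
  ... | no  heavy = ⊥-elim (acyclic p (EqClosure.map avoid-p c))
    where
    avoid-p : ∀ {u v} → Light M (InL L) u v → InL (removeAt L p) u v
    avoid-p (m , light) with ∈-lookup-or-removeAt L p m
    ... | inj₁ eq = ⊥-elim (heavy (subst (λ x → cost x ≤ M) eq light))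
    ... | inj₂ m′ = m′

  module MinimumSpanningForest (G : Graph) (L : List (Pair k)) (msf : IsMinSpanningForest G L) where

    private
      n : ℕ
      n = length L

      in-G : ∀ {z w} → (z , w) ∈ L → G z w ⊎ G w z
      in-G = proj₁ (proj₁ msf)

      spans : ∀ z w → Conn G z w → Conn (InL L) z w
      spans = proj₁ (proj₂ (proj₁ msf))

      acyclic : Acyclic L
      acyclic = proj₂ (proj₂ (proj₁ msf))

      minimal : ∀ L′ → IsSpanningForest G L′ → weight L ≤ weight L′
      minimal = proj₂ msf

    -- An edge of G that reconnects the two sides of forest edge p is not lighter than p,
    -- for otherwise exchanging the two would give a lighter spanning forest.
    exchange : ∀ p x y → G x y ⊎ G y x → dist x y < cost (lookup L p) →
               Conn (InL (removeAt L p)) x (proj₁ (lookup L p)) →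
               Conn (InL (removeAt L p)) (proj₂ (lookup L p)) y → ⊥
    exchange p x y gxy lighter c₁ c₂ =
      <⇒≱ lighter (+-cancelʳ-≤ (weight R) _ _
        (subst (_≤ dist x y + weight R) (weight-removeAt L p) (minimal L′ swapped)))
      where
      R L′ : List (Pair k)
      R  = removeAt L p
      L′ = (x , y) ∷ R

      widen : ∀ {u v} → Conn (InL R) u v → Conn (InL L′) u v
      widen = EqClosure.map there

      -- the removed edge is replaced by the detour through the new edge xy
      reroute : ∀ {u v} → InL L u v → Conn (InL L′) u v
      reroute m with ∈-lookup-or-removeAt L p m
      ... | inj₁ refl = EqClosure.symmetric _ (widen c₁) ◅◅ EqClosure.return (here refl)
                          ◅◅ EqClosure.symmetric _ (widen c₂)
      ... | inj₂ m′   = EqClosure.return (there m′)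

      in-G′ : ∀ {z w} → (z , w) ∈ L′ → G z w ⊎ G w z
      in-G′ (here refl) = gxy
      in-G′ (there m)   = in-G (∈-removeAt⁻ L p m)

      swapped : IsSpanningForest G L′
      swapped = in-G′
              , (λ z w c → (reroute ⋆) (spans z w c))
              , acyclic-cons R (acyclic-removeAt L p acyclic)
                  (λ c → acyclic p (EqClosure.symmetric _ c₁ ◅◅ c ◅◅ EqClosure.symmetric _ c₂))

    -- For a light edge xy of G, sweep through the positions of L, discarding
    -- heavy forest edges one at a time while keeping x and y connected.
    module Sweep (N : ℕ) {x y} (g : G x y) (x~y : dist x y ≤ N) where

      Kept : ℕ → Graph
      Kept j u v = Σ (Fin n) λ q → lookup L q ≡ (u , v) × (cost (lookup L q) ≤ N ⊎ j ≤ toℕ q)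

      module Examine (j : ℕ) (j<n : j < n) where
        p : Fin n
        p  = fromℕ< j<n

        h₁ h₂ : Vec ℕ k
        h₁ = proj₁ (lookup L p)
        h₂ = proj₂ (lookup L p)

        advance : ∀ {u v} → Kept j u v → Kept (suc j) u v ⊎ lookup L p ≡ (u , v)
        advance (q , eq , inj₁ light) = inj₁ (q , eq , inj₁ light)
        advance (q , eq , inj₂ j≤q) with m≤n⇒m<n∨m≡n j≤q
        ... | inj₁ j<q = inj₁ (q , eq , inj₂ j<q)
        ... | inj₂ j≡q with toℕ-injective (trans (sym j≡q) (sym (toℕ-fromℕ< j<n)))
        ...   | refl = inj₂ eq

        avoid : ¬ cost (lookup L p) ≤ N → ∀ {u v} → Kept (suc j) u v → InL (removeAt L p) u v
        avoid heavy (q , eq , kept) = subst (_∈ removeAt L p) eq (lookup-∈-removeAt L p q q≢p)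
          where
          q≢p : q ≢ p
          q≢p refl = [ heavy , (λ j<p → <⇒≱ j<p (≤-reflexive (toℕ-fromℕ< j<n))) ]′ kept

        endpoints : ∀ {u v} → lookup L p ≡ (u , v) → u ≡ h₁ × v ≡ h₂
        endpoints eq = cong proj₁ (sym eq) , cong proj₂ (sym eq)

        -- a heavy edge at p cannot be needed: a path crossing it contradicts exchange
        examine : Conn (Kept j) x y → Conn (Kept (suc j)) x y
        examine c with cost (lookup L p) ≤? N
        ... | yes light = EqClosure.map (λ kept → [ id , (λ eq → p , eq , inj₁ light) ]′ (advance kept)) c
        ... | no heavy with split-at-edge {B = Kept (suc j)} h₁ h₂ (λ kept → map₂ endpoints (advance kept)) c
        ...   | inj₁ c′ = c′
        ...   | inj₂ (inj₁ (c₁ , c₂)) =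
          ⊥-elim (exchange p x y (inj₁ g) (≤-<-trans x~y (≰⇒> heavy))
                   (EqClosure.map (avoid heavy) c₁) (EqClosure.map (avoid heavy) c₂))
        ...   | inj₂ (inj₂ (c₁ , c₂)) =
          ⊥-elim (exchange p y x (inj₂ g) (≤-<-trans (subst (_≤ N) (dist-sym x y) x~y) (≰⇒> heavy))
                   (EqClosure.symmetric _ (EqClosure.map (avoid heavy) c₂))
                   (EqClosure.symmetric _ (EqClosure.map (avoid heavy) c₁)))

      sweep : ∀ j → j ≤ n → Conn (Kept j) x y
      sweep zero    _   = EqClosure.map start (spans x y (EqClosure.return g))
        where
        start : ∀ {u v} → InL L u v → Kept 0 u v
        start m = index m , sym (lookup-index m) , inj₂ z≤n
      sweep (suc j) j<n = Examine.examine j j<n (sweep j (<⇒≤ j<n))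

      light-path : Conn (Light N (InL L)) x y
      light-path = EqClosure.map finish (sweep n ≤-refl)
        where
        finish : ∀ {u v} → Kept n u v → Light N (InL L) u v
        finish (q , eq , inj₁ light) = subst (_∈ L) eq (∈-lookup q) , subst (λ x → cost x ≤ N) eq light
        finish (q , eq , inj₂ n≤q)   = ⊥-elim (<⇒≱ (toℕ<n q) n≤q)

    lightly-connects : ∀ {S} → LightlyConnects S G → LightlyConnects S (InL L)
    lightly-connects G-light N a b sa sb a~b =
      ((λ { (g , light) → Sweep.light-path N g light }) ⋆) (G-light N a b sa sb a~b)

-- The trees T_β lightly connect Z(β)

module Catenary {d k : ℕ} (α : Fin k → Vec ℕ d) (minimal-α : IsMinimalGenerators α)
                (H : Pair k → Set) (graver : IsGraverBasis α H)
                (T : Vec ℕ d → List (Pair k)) (T-family : IsTFamily α H T) where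

  open Forests {k}

  G : Vec ℕ d → Graph
  G = Gβ α H T

  graver-kernel : ∀ x y → H (x , y) → φ α x ≡ φ α y
  graver-kernel x y = proj₁ graver (x , y)

  sumP : List (Pair k) → Pair k
  sumP = foldr _⊕p_ (0v , 0v)

  atom-size-positive : ∀ i → 0 < ∣ α i ∣
  atom-size-positive i = n≢0⇒n>0 λ size≡0 →
    minimal-generator-≢-identity (≡-dec _≟_) ⊕-identityˡ (proj₂ minimal-α) (α i) (i , refl)
      (∣∣≡0⇒≡0v (α i) size≡0)

  descent : ∀ {β′ β} i → β′ ⊕ α i ≡ β → ∣ β′ ∣ < ∣ β ∣
  descent {β′} {β} i eq = begin-strict
    ∣ β′ ∣           <⟨ m<m+n ∣ β′ ∣ (atom-size-positive i) ⟩
    ∣ β′ ∣ + ∣ α i ∣ ≡⟨ ∣⊕∣ β′ (α i) ⟨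
    ∣ β′ ⊕ α i ∣     ≡⟨ cong ∣_∣ eq ⟩
    ∣ β ∣            ∎
    where open ≤-Reasoning

  -- If T_β has an edge, then |Z(β)| ≥ 2 and T_β is a minimum spanning forest of G_β.
  forest : ∀ β {x} → x ∈ T β → IsMinSpanningForest (G β) (T β)
  forest β {x} x∈T = proj₂ (T-family β) λ one → ∉[] (subst (x ∈_) (proj₁ (T-family β) one) x∈T)

  T-edge-factorizations : ∀ β {u v} → (u , v) ∈ T β → Z α β u × Z α β v
  T-edge-factorizations β m with proj₁ (proj₁ (forest β m)) m
  ... | inj₁ (zu , zv , _) = zu , zv
  ... | inj₂ (zv , zu , _) = zu , zv

  tree-lightly : ∀ β → LightlyConnects (Z α β) (G β) → LightlyConnects (Z α β) (InL (T β))
  tree-lightly β G-light N a b za zb a~b with ≡-dec _≟_ a b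
  ... | yes refl = ε
  ... | no  a≢b  = MinimumSpanningForest.lightly-connects (G β) (T β)
                     (proj₂ (T-family β) (λ one → a≢b (one a b za zb))) G-light N a b za zb a~b

  kernel-swap : ∀ {β} x y u → φ α x ≡ φ α y → Z α β (x ⊕ u) → Z α β (y ⊕ u)
  kernel-swap {β} x y u φx≡φy zx = begin
    φ α (y ⊕ u)   ≡⟨ φ-⊕ α y u ⟩
    φ α y ⊕ φ α u ≡⟨ cong (_⊕ φ α u) φx≡φy ⟨
    φ α x ⊕ φ α u ≡⟨ φ-⊕ α x u ⟨
    φ α (x ⊕ u)   ≡⟨ zx ⟩
    β             ∎
    where open ≡-Reasoning

  excess-kernel : ∀ {β} a b → Z α β a → Z α β b → KerMonoid α (excess a b , excess b a)
  excess-kernel {β} a b za zb = ⊕-cancelʳ _ _ (φ α g) (begin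
    φ α (excess a b) ⊕ φ α g ≡⟨ φ-⊕ α (excess a b) g ⟨
    φ α (excess a b ⊕ g)     ≡⟨ cong (φ α) (excess-split a b) ⟩
    φ α a                    ≡⟨ trans za (sym zb) ⟩
    φ α b                    ≡⟨ cong (φ α) (excess-split′ a b) ⟨
    φ α (excess b a ⊕ g)     ≡⟨ φ-⊕ α (excess b a) g ⟩
    φ α (excess b a) ⊕ φ α g ∎)
    where
    g : Vec ℕ k
    g = gcdv a b
    open ≡-Reasoning

  module Step (β : Vec ℕ d)
              (below : ∀ {β′} i → β′ ⊕ α i ≡ β → LightlyConnects (Z α β′) (InL (T β′))) where

    cover-move : ∀ {N} i a b → Z α β (a ⊕ e i) → Z α β (b ⊕ e i) → dist a b ≤ N →
                 Conn (Light N (G β)) (a ⊕ e i) (b ⊕ e i)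
    cover-move {N} i a b za zb a~b =
      EqClosure.gmap (_⊕ e i) shift (below i β′+αi≡β N a b refl zb′ a~b)
      where
      β′ : Vec ℕ d
      β′ = φ α a
      β′+αi≡β : β′ ⊕ α i ≡ β
      β′+αi≡β = trans (sym (φ-⊕e α i a)) za
      shifted : ∀ u → Z α β′ u → Z α β (u ⊕ e i)
      shifted u zu = trans (φ-⊕e α i u) (trans (cong (_⊕ α i) zu) β′+αi≡β)
      zb′ : Z α β′ b
      zb′ = ⊕-cancelʳ (φ α b) β′ (α i) (trans (sym (φ-⊕e α i b)) (trans zb (sym β′+αi≡β)))
      shift : ∀ {u v} → Light N (InL (T β′)) u v → Light N (G β) (u ⊕ e i) (v ⊕ e i)
      shift {u} {v} (m , light) =
        ( shifted u (proj₁ (T-edge-factorizations β′ m))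
        , shifted v (proj₂ (T-edge-factorizations β′ m))
        , inj₁ (i , β′ , β′+αi≡β , u , v , refl , refl , m) )
        , subst (_≤ N) (sym (dist-translate u v (e i))) light

    -- Exchanging a Graver element (x, y) inside a factorization x ⊕ u is a light path:
    -- an edge of E' if u = 0, and a cover move otherwise.
    graver-move : ∀ {N} x y → H (x , y) → ∀ u → Z α β (x ⊕ u) → dist x y ≤ N →
                  Conn (Light N (G β)) (x ⊕ u) (y ⊕ u)
    graver-move {N} x y hxy u zx x~y with zero-or-unit u
    ... | inj₁ refl =
      subst₂ (Conn (Light N (G β))) (sym (⊕-identityʳ x)) (sym (⊕-identityʳ y))
        (EqClosure.return ((drop-0v x zx , drop-0v y (kernel-swap x y 0v (graver-kernel x y hxy) zx) , inj₂ hxy) , x~y))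
      where
      drop-0v : ∀ v → Z α β (v ⊕ 0v) → Z α β v
      drop-0v v = subst (Z α β) (⊕-identityʳ v)
    ... | inj₂ (i , u′ , refl) =
      subst₂ (Conn (Light N (G β))) (⊕-assoc x u′ (e i)) (⊕-assoc y u′ (e i))
        (cover-move i (x ⊕ u′) (y ⊕ u′) (reassoc x zx) (reassoc y (kernel-swap x y (u′ ⊕ e i) (graver-kernel x y hxy) zx))
          (subst (_≤ N) (sym (dist-translate x y u′)) x~y))
      where
      reassoc : ∀ v → Z α β (v ⊕ (u′ ⊕ e i)) → Z α β ((v ⊕ u′) ⊕ e i)
      reassoc v = subst (Z α β) (sym (⊕-assoc v u′ (e i)))

    graver-chain : ∀ {N} hs → All H hs → ∀ g →
      Z α β (proj₁ (sumP hs) ⊕ g) → Z α β (proj₂ (sumP hs) ⊕ g) → size (sumP hs) ≤ N →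
      Conn (Light N (G β)) (proj₁ (sumP hs) ⊕ g) (proj₂ (sumP hs) ⊕ g)
    graver-chain []               []           g _  _  _     = ε
    graver-chain {N} ((z , w) ∷ hs) (hzw ∷ H-hs) g za zb small = first ◅◅ rest
      where
      c c′ : Vec ℕ k
      c  = proj₁ (sumP hs)
      c′ = proj₂ (sumP hs)
      -- (w ⊕ c) ⊕ g ≡ c ⊕ (w ⊕ g): after the first exchange, w joins the common part
      regroup : ∀ c → (w ⊕ c) ⊕ g ≡ c ⊕ (w ⊕ g)
      regroup c = ⊕-Reorder.xy∙z≈y∙xz w c g
      za′ : Z α β (z ⊕ (c ⊕ g))
      za′ = subst (Z α β) (⊕-assoc z c g) za
      first : Conn (Light N (G β)) ((z ⊕ c) ⊕ g) ((w ⊕ c) ⊕ g)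
      first = subst₂ (Conn (Light N (G β))) (sym (⊕-assoc z c g)) (sym (⊕-assoc w c g))
                (graver-move z w hzw (c ⊕ g) za′
                   (≤-trans (dist≤size z w) (≤-trans (size-≤ˡ (z , w) (c , c′)) small)))
      zmid : Z α β (c ⊕ (w ⊕ g))
      zmid = subst (Z α β) (trans (sym (⊕-assoc w c g)) (regroup c)) (kernel-swap z w (c ⊕ g) (graver-kernel z w hzw) za′)
      rest : Conn (Light N (G β)) ((w ⊕ c) ⊕ g) ((w ⊕ c′) ⊕ g)
      rest = subst₂ (Conn (Light N (G β))) (sym (regroup c)) (sym (regroup c′))
               (graver-chain hs H-hs (w ⊕ g) zmid (subst (Z α β) (regroup c′) zb)
                  (≤-trans (size-≤ʳ (z , w) (c , c′)) small))

    -- Decompose (a - gcd(a,b), b - gcd(a,b)) into Graver elements and exchange them.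
    G-lightly : LightlyConnects (Z α β) (G β)
    G-lightly N a b za zb a~b with proj₁ (proj₂ graver) (excess a b , excess b a) (excess-kernel a b za zb)
    ... | hs , H-hs , hs≡ =
      subst₂ (Conn (Light N (G β))) a-split b-split
        (graver-chain hs H-hs (gcdv a b) (subst (Z α β) (sym a-split) za) (subst (Z α β) (sym b-split) zb) small)
      where
      a-split : proj₁ (sumP hs) ⊕ gcdv a b ≡ a
      a-split = trans (cong (λ p → proj₁ p ⊕ gcdv a b) hs≡) (excess-split a b)
      b-split : proj₂ (sumP hs) ⊕ gcdv a b ≡ b
      b-split = trans (cong (λ p → proj₂ p ⊕ gcdv a b) hs≡) (excess-split′ a b)
      small : size (sumP hs) ≤ N
      small = subst (_≤ N) (trans (dist-excess a b) (cong size (sym hs≡))) a~b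

  G-lightly : ∀ β → LightlyConnects (Z α β) (G β)
  G-lightly = All.wfRec (On.wellFounded ∣_∣ <-wellFounded) 0ℓ (λ β → LightlyConnects (Z α β) (G β))
    λ β below → Step.G-lightly β (λ {β′} i eq → tree-lightly β′ (below (descent i eq)))

  T-lightly : ∀ β → LightlyConnects (Z α β) (InL (T β))
  T-lightly β = tree-lightly β (G-lightly β)

  T-chains : ∀ γ → AllNChained α γ (maxDist (T γ))
  T-chains γ z w zz zw = Star.map step (T-lightly γ (dist z w) z w zz zw ≤-refl)
    where
    step : ∀ {u v} → SymClosure (Light (dist z w) (InL (T γ))) u v → ChainStep α γ (maxDist (T γ)) u v
    step (fwd (m , _)) =
      proj₁ (T-edge-factorizations γ m) , proj₂ (T-edge-factorizations γ m) , ≤-maxDist (T γ) m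
    step {u} {v} (bwd (m , _)) =
      proj₂ (T-edge-factorizations γ m) , proj₁ (T-edge-factorizations γ m) ,
      subst (_≤ maxDist (T γ)) (dist-sym v u) (≤-maxDist (T γ) m)

  -- An M-chain between the endpoints of an edge of T_γ yields a light path of T_γ,
  -- so by acyclicity every edge of T_γ weighs at most M.
  T-minimal : ∀ γ M → AllNChained α γ M → maxDist (T γ) ≤ M
  T-minimal γ M chained = maxDist-≤ (T γ) bound
    where
    bound : ∀ p → cost (lookup (T γ) p) ≤ M
    bound p = acyclic-light-bound (T γ) (proj₂ (proj₂ (proj₁ (forest γ edge)))) p M light-path
      where
      edge : lookup (T γ) p ∈ T γ
      edge = ∈-lookup p
      ends : Z α γ (proj₁ (lookup (T γ) p)) × Z α γ (proj₂ (lookup (T γ) p))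
      ends = T-edge-factorizations γ edge
      light-path : Conn (Light M (InL (T γ))) (proj₁ (lookup (T γ) p)) (proj₂ (lookup (T γ) p))
      light-path = ((λ { (zu , zv , u~v) → T-lightly γ M _ _ zu zv u~v }) ⋆)
                     (Star.map fwd (chained _ _ (proj₁ ends) (proj₂ ends)))

theorem4p12 : ∀ {d k} (α : Fin k → Vec ℕ d) → IsMinimalGenerators α →
    (H : Pair k → Set) → IsGraverBasis α H →
    (T : Vec ℕ d → List (Pair k)) → IsTFamily α H T →
    ∀ γ → InΓ α γ → IsCatenaryDegree α γ (maxDist (T γ))
theorem4p12 α minimal-α H graver T T-family γ _ = T-chains γ , T-minimal γ
  where open Catenary α minimal-α H graver T T-family
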